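{- Let $\mathbb F$ be a field with $|\mathbb F|>k$, let $n>k\ge 1$ with $n+k$ odd, and let $S$ be a linear map on $\mathrm{M}_{(n-1)\,k}(\mathbb F)$ such that $\det_{(n-1)\,k}(S(Y)) = \det_{(n-1)\,k}(Y)$ for all $Y\in\mathrm{M}_{(n-1)\,k}(\mathbb F)$. Define the linear map $T = L^{+}\circ S\circ L^{ - }$ on $\mathrm{M}_{n\,k}(\mathbb F)$. Then $\det_{n\,k}(T(X))=\det_{n\,k}(X)$ for all $X\in\mathrm{M}_{n\,k}(\mathbb F)$.
   Context: $|\mathbb F|>k$ means $\mathbb F$ is infinite or finite with more than $k$ elements. For $m \ge k$ and $X=(x_{i\,j})\in\mathrm{M}_{m\,k}(\mathbb F)$, the Cullis determinant is $\det_{m\,k}(X) = \sum_{\sigma} \operatorname{sgn}_{m\,k}(\sigma)\, x_{\sigma(1)\,1}\cdots x_{\sigma(k)\,k}$, the sum over all injections $\sigma\colon\{1,\ldots,k\}\to\{1,\ldots,m\}$, where, writing $\sigma(\{1,\dots,k\})=\{i_1<\cdots<i_k\}$, $\operatorname{sgn}_{m\,k}(\sigma)=\operatorname{sgn}(\pi_\sigma)(-1)^{\sum_{\alpha=1}^k(i_\alpha-\alpha)}$ with $\pi_\sigma$ the permutation of $\{i_1,\dots,i_k\}$ sending $i_\alpha\mapsto\sigma(\alpha)$. For $X\in\mathrm{M}_{n\,k}(\mathbb F)$, $L^{ - }(X)\in\mathrm{M}_{(n-1)\,k}(\mathbb F)$ has $r$-th row equal to (row $r$ of $X$) minus (row $n$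 of $X$), $1\le r\le n-1$. For $Y\in\mathrm{M}_{(n-1)\,k}(\mathbb F)$, $L^{+}(Y)\in\mathrm{M}_{n\,k}(\mathbb F)$ is $Y$ with a zero row adjoined as the last row. -}

module Defs where

open import Level using (Level; _⊔_) renaming (suc to lsuc)
open import Algebra.Bundles using (CommutativeRing)
open import Data.Nat as ℕ using (ℕ; zero; suc)
open import Data.Fin as Fin using (Fin; zero; suc; toℕ; fromℕ; inject₁)
open import Data.Fin.Properties using () renaming (_≟_ to _≟ᶠ_)
open import Data.List as List using (List; []; _∷_; concatMap; map; filter; foldr; allFin; length)
open import Data.Bool using (Bool; true; false; _∧_; not)
open import Data.Product using (Σ; ∃; _×_; _,_)
open import Relation.Nullary using (¬_; does)
open import Relation.Nullary.Decidable using (⌊_⌋)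
open import Relation.Binary.PropositionalEquality using (_≡_)

record Field (c ℓ : Level) : Set (lsuc (c ⊔ ℓ)) where
  field
    commutativeRing : CommutativeRing c ℓ
  open CommutativeRing commutativeRing public
  field
    1≉0     : ¬ (1# ≈ 0#)
    inverse : ∀ x → ¬ (x ≈ 0#) → Σ Carrier (λ y → x * y ≈ 1#)

module _ {c ℓ : Level} (F : Field c ℓ) where
  open Field F using (Carrier; _≈_; _+_; _*_; -_; _-_; 0#; 1#)

  CardGreaterThan : ℕ → Set (c ⊔ ℓ)
  CardGreaterThan k =
    Σ (Fin (suc k) → Carrier) λ f → ∀ i j → f i ≈ f j → i ≡ j

  Mat : ℕ → ℕ → Set c
  Mat m k = Fin m → Fin k → Carrier

  _≈ᴹ_ : ∀ {m k} → Mat m k → Mat m k → Set ℓ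
  X ≈ᴹ Y = ∀ i j → X i j ≈ Y i j

  _+ᴹ_ : ∀ {m k} → Mat m k → Mat m k → Mat m k
  (X +ᴹ Y) i j = X i j + Y i j

  _·ᴹ_ : ∀ {m k} → Carrier → Mat m k → Mat m k
  (a ·ᴹ X) i j = a * X i j

  record IsLinear {m k : ℕ} (S : Mat m k → Mat m k) : Set (c ⊔ ℓ) where
    field
      cong     : ∀ {X Y} → X ≈ᴹ Y → S X ≈ᴹ S Y
      additive : ∀ X Y → S (X +ᴹ Y) ≈ᴹ (S X +ᴹ S Y)
      homog    : ∀ a X → S (a ·ᴹ X) ≈ᴹ (a ·ᴹ S X)

  negOnePow : ℕ → Carrier
  negOnePow zero    = 1#
  negOnePow (suc e) = - negOnePow e

  allFuns : (k m : ℕ) → List (Fin k → Fin m)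
  allFuns zero    m = (λ ()) ∷ []
  allFuns (suc k) m =
    concatMap (λ i → map (λ f → λ { zero → i ; (suc a) → f a }) (allFuns k m)) (allFin m)

  pairsLt : (k : ℕ) → List (Fin k × Fin k)
  pairsLt k = filter (λ { (a , b) → toℕ a ℕ.<? toℕ b })
                (concatMap (λ a → map (λ b → (a , b)) (allFin k)) (allFin k))

  isInjective : ∀ {k m} → (Fin k → Fin m) → Bool
  isInjective {k} σ =
    foldr (λ { (a , b) r → not ⌊ σ a ≟ᶠ σ b ⌋ ∧ r }) true (pairsLt k)

  injections : (k m : ℕ) → List (Fin k → Fin m)
  injections k m = filter (λ σ → isInjective σ Data.Bool.≟ true) (allFuns k m)

  -- number of inversions of the sequence σ(1),…,σ(k); its parity is the
  -- sign of the permutation π_σ of {i_1<…<i_k} sending i_α ↦ σ(α).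
  inversions : ∀ {k m} → (Fin k → Fin m) → ℕ
  inversions {k} σ =
    length (filter (λ { (a , b) → toℕ (σ b) ℕ.<? toℕ (σ a) }) (pairsLt k))

  sumℕ : ∀ {k} → (Fin k → ℕ) → ℕ
  sumℕ {k} f = foldr ℕ._+_ 0 (map f (allFin k))

  -- Σ_α (i_α − α)  =  Σ_α σ(α) − Σ_α α   (0-based indices; the shift cancels)
  shiftExp : ∀ {k m} → (Fin k → Fin m) → ℕ
  shiftExp {k} σ = sumℕ (λ a → toℕ (σ a)) ℕ.∸ sumℕ {k} toℕ

  sgnCullis : ∀ {k m} → (Fin k → Fin m) → Carrier
  sgnCullis σ = negOnePow (inversions σ) * negOnePow (shiftExp σ)

  prodF : ∀ {k} → (Fin k → Carrier) → Carrier
  prodF {k} f = foldr _*_ 1# (map f (allFin k))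

  detC : ∀ {m k} → Mat m k → Carrier
  detC {m} {k} X =
    foldr _+_ 0#
      (map (λ σ → sgnCullis σ * prodF (λ j → X (σ j) j)) (injections k m))

  Lminus : ∀ {m k} → Mat (suc m) k → Mat m k
  Lminus {m} X r j = X (inject₁ r) j - X (fromℕ m) j

  -- L⁺ : M_{(n-1) k} → M_{n k}, adjoin a zero last row
  Lplus : ∀ {m k} → Mat m k → Mat (suc m) k
  Lplus {zero}  Y zero    j = 0#
  Lplus {suc m} Y zero    j = Y zero j
  Lplus {suc m} Y (suc r) j = Lplus (λ r' → Y (suc r')) r j

{-# OPTIONS --safe #-}
-- Expanding the Cullis determinant along its first column gives
--   det X = Σᵢ (-1)ⁱ X i 0 · det (X without row i and column 0),
-- because prepending i to an injection τ that avoids i multiplies its sign by (-1)ⁱ.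
-- A zero last row contributes nothing to this expansion, so det ∘ L⁺ = det.
-- In the expansion of det (L⁻ X) the minors are L⁻ of minors of X, and subtracting the
-- last row contributes -x · Σ_{r<n-1} (-1)ʳ det (minor r X), x the last entry of column 0.
-- When n + k is odd the full alternating sum Σ_{r<n} (-1)ʳ det (minor r X) vanishes, since
-- in its double expansion the terms removing rows r and t in either order cancel; so that
-- contribution is the missing last term of the expansion of det X, and by induction
-- det ∘ L⁻ = det.
module Submission where

open import Defs
open import Level using (Level)
open import Data.Bool as Bool using (Bool; true; false; not; _∧_; if_then_else_)
open import Data.Bool.Properties using (∧-assoc; ∧-conicalˡ; ∧-conicalʳ)
open import Data.Nat as ℕ using (ℕ; zero; suc; _≤_; _<_; _%_; s≤s; z≤n)
import Data.Nat.Properties as ℕₚ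
open import Algebra.Properties.CommutativeMonoid.Sum ℕₚ.+-0-commutativeMonoid
  using () renaming (sum to ∑ℕ; ∑-distrib-+ to ∑ℕ-distrib-+; sum-cong-≗ to ∑ℕ-cong)
open import Data.Nat.Tactic.RingSolver using (solve-∀)
open import Data.Fin using (Fin; zero; suc; toℕ; fromℕ; inject₁; punchIn; punchOut)
import Data.Fin.Properties as Finₚ
open import Data.Fin.Properties using (_≟_)
open import Data.List using (List; []; _∷_; _++_; map; foldr; filter; concatMap; tabulate; allFin; length)
import Data.List.Properties as Listₚ
open import Data.List.Relation.Unary.All.Properties using (tabulate⁺)
open import Data.Vec.Functional using (removeAt) renaming (_∷_ to _∷ᵛ_)
open import Data.Product as Prod using (Σ; _×_; _,_; proj₁; proj₂)
open import Function using (_∘_; id)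
open import Relation.Nullary using (Dec; does; yes; no; ¬_)
open import Relation.Nullary.Decidable using (⌊_⌋; dec-true; dec-false)
open import Relation.Nullary.Negation using (contradiction)
open import Relation.Binary.PropositionalEquality as ≡ using (_≡_; _≢_; _≗_)

private variable A B : Set

isYes-true : ∀ {p} {P : Set p} (P? : Dec P) → P → ⌊ P? ⌋ ≡ true
isYes-true (yes _) _  = ≡.refl
isYes-true (no ¬p) p = contradiction p ¬p

isYes-false : ∀ {p} {P : Set p} (P? : Dec P) → ¬ P → ⌊ P? ⌋ ≡ false
isYes-false (yes p) ¬p = contradiction p ¬p
isYes-false (no _)  _  = ≡.refl

ordered? : ∀ {k} (p : Fin k × Fin k) → Dec (toℕ (proj₁ p) < toℕ (proj₂ p))
ordered? p = toℕ (proj₁ p) ℕ.<? toℕ (proj₂ p)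

filter-concatMap : ∀ {p} {P : B → Set p} (P? : ∀ x → Dec (P x)) (g : A → List B) xs →
                   filter P? (concatMap g xs) ≡ concatMap (filter P? ∘ g) xs
filter-concatMap P? g []       = ≡.refl
filter-concatMap P? g (x ∷ xs) =
  ≡.trans (Listₚ.filter-++ P? (g x) (concatMap g xs)) (≡.cong (filter P? (g x) ++_) (filter-concatMap P? g xs))

filter-map-comm : ∀ {p q} {P : A → Set p} {Q : B → Set q} (P? : ∀ x → Dec (P x)) (Q? : ∀ x → Dec (Q x)) {f : B → A} →
                  (∀ x → does (P? (f x)) ≡ does (Q? x)) → ∀ xs → filter P? (map f xs) ≡ map f (filter Q? xs)
filter-map-comm P? Q? {f} same []       = ≡.refl
filter-map-comm P? Q? {f} same (x ∷ xs) with does (P? (f x)) | does (Q? x) | same x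
... | true  | .true  | ≡.refl = ≡.cong (f x ∷_) (filter-map-comm P? Q? same xs)
... | false | .false | ≡.refl = filter-map-comm P? Q? same xs

length-filter-map : ∀ {p q} {P : A → Set p} {Q : B → Set q} (P? : ∀ x → Dec (P x)) (Q? : ∀ x → Dec (Q x)) {f : B → A} →
                    (∀ x → does (P? (f x)) ≡ does (Q? x)) → ∀ xs → length (filter P? (map f xs)) ≡ length (filter Q? xs)
length-filter-map P? Q? {f} same xs = ≡.trans (≡.cong length (filter-map-comm P? Q? same xs)) (Listₚ.length-map f (filter Q? xs))

allOf : ∀ {k} → (Fin k → Bool) → Bool
allOf {zero}  p = true
allOf {suc k} p = p zero ∧ allOf (p ∘ suc)

allOf-true : ∀ {k} (p : Fin k → Bool) → allOf p ≡ true → ∀ b → p b ≡ true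
allOf-true p all≡true zero    = ∧-conicalˡ (p zero) _ all≡true
allOf-true p all≡true (suc b) = allOf-true (p ∘ suc) (∧-conicalʳ (p zero) _ all≡true) b

foldr-∧-tabulate : ∀ {k} (p : A → Bool) (g : Fin k → A) z → foldr (λ x r → p x ∧ r) z (tabulate g) ≡ allOf (p ∘ g) ∧ z
foldr-∧-tabulate {k = zero}  p g z = ≡.refl
foldr-∧-tabulate {k = suc k} p g z =
  ≡.trans (≡.cong (p (g zero) ∧_) (foldr-∧-tabulate p (g ∘ suc) z)) (≡.sym (∧-assoc (p (g zero)) _ z))

∑ℕ-suc : ∀ {k} (f : Fin k → ℕ) → ∑ℕ (λ b → suc (f b)) ≡ ∑ℕ f ℕ.+ k
∑ℕ-suc {zero}  f = ≡.refl
∑ℕ-suc {suc k} f = ≡.trans (≡.cong (λ x → suc (f zero ℕ.+ x)) (∑ℕ-suc (f ∘ suc)))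
                            (≡.trans (≡.cong suc (≡.sym (ℕₚ.+-assoc (f zero) _ k))) (≡.sym (ℕₚ.+-suc _ k)))

∑ℕ-tabulate : ∀ {k} (f : A → ℕ) (g : Fin k → A) → foldr ℕ._+_ 0 (map f (tabulate g)) ≡ ∑ℕ (f ∘ g)
∑ℕ-tabulate {k = zero}  f g = ≡.refl
∑ℕ-tabulate {k = suc k} f g = ≡.cong (f (g zero) ℕ.+_) (∑ℕ-tabulate f (g ∘ suc))

count : ∀ {k} → (Fin k → Bool) → ℕ
count p = ∑ℕ (λ b → if p b then 1 else 0)

count-complement : ∀ {k} (p : Fin k → Bool) → count p ℕ.+ count (not ∘ p) ≡ k
count-complement {zero}  p = ≡.refl
count-complement {suc k} p with p zero
... | true  = ≡.cong suc (count-complement (p ∘ suc))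
... | false = ≡.trans (ℕₚ.+-suc _ _) (≡.cong suc (count-complement (p ∘ suc)))

count-cong : ∀ {k} {p q : Fin k → Bool} → (∀ b → p b ≡ q b) → count p ≡ count q
count-cong p≗q = ∑ℕ-cong (≡.cong (λ t → if t then 1 else 0) ∘ p≗q)

length-filter-tabulate : ∀ {k p} {P : A → Set p} (P? : ∀ x → Dec (P x)) (g : Fin k → A) →
                         length (filter P? (tabulate g)) ≡ count (λ b → does (P? (g b)))
length-filter-tabulate {k = zero}  P? g = ≡.refl
length-filter-tabulate {k = suc k} P? g with does (P? (g zero))
... | true  = ≡.cong suc (length-filter-tabulate P? (g ∘ suc))
... | false = length-filter-tabulate P? (g ∘ suc)

filter-does-cong : ∀ {p q} {P : A → Set p} {Q : A → Set q} (P? : ∀ x → Dec (P x)) (Q? : ∀ x → Dec (Q x)) →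
                   (∀ x → does (P? x) ≡ does (Q? x)) → ∀ xs → filter P? xs ≡ filter Q? xs
filter-does-cong P? Q? same xs =
  ≡.trans (≡.cong (filter P?) (≡.sym (Listₚ.map-id xs))) (≡.trans (filter-map-comm P? Q? same xs) (Listₚ.map-id _))

toℕ-punchIn : ∀ {m} (j : Fin (suc m)) (y : Fin m) →
              toℕ (punchIn j y) ≡ toℕ y ℕ.+ (if not (toℕ y ℕ.<ᵇ toℕ j) then 1 else 0)
toℕ-punchIn zero    y       = ℕₚ.+-comm 1 (toℕ y)
toℕ-punchIn (suc j) zero    = ≡.refl
toℕ-punchIn (suc j) (suc y) = ≡.cong suc (toℕ-punchIn j y)

punchIn-<ᵇ : ∀ {m} (i : Fin (suc m)) (x y : Fin m) → (toℕ (punchIn i x) ℕ.<ᵇ toℕ (punchIn i y)) ≡ (toℕ x ℕ.<ᵇ toℕ y)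
punchIn-<ᵇ zero    x       y       = ≡.refl
punchIn-<ᵇ (suc i) zero    zero    = ≡.refl
punchIn-<ᵇ (suc i) zero    (suc y) = ≡.refl
punchIn-<ᵇ (suc i) (suc x) zero    = ≡.refl
punchIn-<ᵇ (suc i) (suc x) (suc y) = punchIn-<ᵇ i x y

punchIn-<ᵇ-below : ∀ {m} (j : Fin (suc m)) (y : Fin m) {x} → x ≤ toℕ j → (toℕ (punchIn j y) ℕ.<ᵇ x) ≡ (toℕ y ℕ.<ᵇ x)
punchIn-<ᵇ-below zero    y       z≤n       = ≡.refl
punchIn-<ᵇ-below (suc j) zero    x≤j       = ≡.refl
punchIn-<ᵇ-below (suc j) (suc y) z≤n       = ≡.refl
punchIn-<ᵇ-below (suc j) (suc y) (s≤s x≤j) = punchIn-<ᵇ-below j y x≤j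

punchIn-<ᵇ-above : ∀ {m} (j : Fin (suc m)) (y : Fin m) {x} → toℕ j ≤ x → (toℕ (punchIn j y) ℕ.<ᵇ suc x) ≡ (toℕ y ℕ.<ᵇ x)
punchIn-<ᵇ-above zero    y       j≤x       = ≡.refl
punchIn-<ᵇ-above (suc j) zero    (s≤s j≤x) = ≡.refl
punchIn-<ᵇ-above (suc j) (suc y) (s≤s j≤x) = punchIn-<ᵇ-above j y j≤x

punchIn-≟ : ∀ {m} (i : Fin (suc m)) (x y : Fin m) → ⌊ punchIn i x ≟ punchIn i y ⌋ ≡ ⌊ x ≟ y ⌋
punchIn-≟ i x y with x ≟ y
... | yes ≡.refl = isYes-true (punchIn i x ≟ punchIn i x) ≡.refl
... | no x≢y     = isYes-false (punchIn i x ≟ punchIn i y) (x≢y ∘ Finₚ.punchIn-injective i x y)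

∑toℕ-punchIn : ∀ {k m} (j : Fin (suc m)) (h : Fin k → Fin m) →
               ∑ℕ (λ b → toℕ (punchIn j (h b))) ≡ ∑ℕ (toℕ ∘ h) ℕ.+ count (λ b → not (toℕ (h b) ℕ.<ᵇ toℕ j))
∑toℕ-punchIn j h = ≡.trans (∑ℕ-cong (toℕ-punchIn j ∘ h)) (∑ℕ-distrib-+ (toℕ ∘ h) _)

punchIn-inject₁ : ∀ {n} (r : Fin (suc n)) (s : Fin n) → punchIn (inject₁ r) (inject₁ s) ≡ inject₁ (punchIn r s)
punchIn-inject₁ zero    s       = ≡.refl
punchIn-inject₁ (suc r) zero    = ≡.refl
punchIn-inject₁ (suc r) (suc s) = ≡.cong suc (punchIn-inject₁ r s)

punchIn-inject₁-last : ∀ {n} (r : Fin (suc n)) → punchIn (inject₁ r) (fromℕ n) ≡ fromℕ (suc n)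
punchIn-inject₁-last         zero    = ≡.refl
punchIn-inject₁-last {suc n} (suc r) = ≡.cong suc (punchIn-inject₁-last r)

-- Removing entry t and then entry u of what remains removes the same two entries as
-- removing entry punchIn t u first and then entry swapIndex t u.
swapIndex : ∀ {n} → Fin (suc (suc n)) → Fin (suc n) → Fin (suc n)
swapIndex         zero    u       = zero
swapIndex         (suc t) zero    = t
swapIndex {suc n} (suc t) (suc u) = suc (swapIndex t u)

punchIn-swapIndex : ∀ {n} (t : Fin (suc (suc n))) (u : Fin (suc n)) → punchIn (punchIn t u) (swapIndex t u) ≡ t
punchIn-swapIndex         zero    u       = ≡.refl
punchIn-swapIndex         (suc t) zero    = ≡.refl
punchIn-swapIndex {suc n} (suc t) (suc u) = ≡.cong suc (punchIn-swapIndex t u)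

punchIn-punchIn-swapIndex : ∀ {n} (t : Fin (suc (suc n))) (u : Fin (suc n)) (v : Fin n) →
                            punchIn (punchIn t u) (punchIn (swapIndex t u) v) ≡ punchIn t (punchIn u v)
punchIn-punchIn-swapIndex         zero    u       v       = ≡.refl
punchIn-punchIn-swapIndex         (suc t) zero    v       = ≡.refl
punchIn-punchIn-swapIndex {suc n} (suc t) (suc u) zero    = ≡.refl
punchIn-punchIn-swapIndex {suc n} (suc t) (suc u) (suc v) = ≡.cong suc (punchIn-punchIn-swapIndex t u v)

punchOut-swapIndex : ∀ {n} (t : Fin (suc (suc n))) (u : Fin (suc n)) (r≢t : punchIn t u ≢ t) → punchOut r≢t ≡ swapIndex t u
punchOut-swapIndex t u r≢t = Finₚ.punchIn-injective (punchIn t u) _ _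
  (≡.trans (Finₚ.punchIn-punchOut r≢t) (≡.sym (punchIn-swapIndex t u)))

even-pred : ∀ x → suc x % 2 ≡ 1 → x % 2 ≡ 0
even-pred zero          _     = ≡.refl
even-pred (suc (suc x)) x-odd = even-pred x x-odd

module Injections {c ℓ : Level} (F : Field c ℓ) where

  pairsLt-suc : ∀ k → pairsLt F (suc k) ≡ tabulate (λ b → zero , suc b) ++ map (Prod.map suc suc) (pairsLt F k)
  pairsLt-suc k = ≡.trans (Listₚ.filter-++ ordered? (map (zero ,_) (allFin (suc k))) (concatMap row (tabulate suc)))
                          (≡.cong₂ _++_ firstRow laterRows)
    where
    open ≡.≡-Reasoning
    row : Fin (suc k) → List (Fin (suc k) × Fin (suc k))
    row a = map (a ,_) (allFin (suc k))
    firstRow : filter ordered? (map (zero ,_) (tabulate suc)) ≡ tabulate (λ b → zero , suc b)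
    firstRow = ≡.trans (≡.cong (filter ordered?) (Listₚ.map-tabulate suc (zero ,_)))
                       (Listₚ.filter-all ordered? (tabulate⁺ (λ b → ℕ.z<s)))
    laterRows : filter ordered? (concatMap row (tabulate suc)) ≡ map (Prod.map suc suc) (pairsLt F k)
    laterRows = begin
      filter ordered? (concatMap row (tabulate suc))
        ≡⟨ ≡.cong (filter ordered? ∘ concatMap row) (Listₚ.map-tabulate id suc) ⟨
      filter ordered? (concatMap row (map suc (allFin k)))
        ≡⟨ ≡.cong (filter ordered?) (Listₚ.concatMap-map row suc (allFin k)) ⟩
      filter ordered? (concatMap (row ∘ suc) (allFin k))
        ≡⟨ filter-concatMap ordered? (row ∘ suc) (allFin k) ⟩
      concatMap (filter ordered? ∘ row ∘ suc) (allFin k)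
        ≡⟨ Listₚ.concatMap-cong laterRow (allFin k) ⟩
      concatMap (map (Prod.map suc suc) ∘ filter ordered? ∘ rowₖ) (allFin k)
        ≡⟨ Listₚ.map-concatMap (Prod.map suc suc) (filter ordered? ∘ rowₖ) (allFin k) ⟨
      map (Prod.map suc suc) (concatMap (filter ordered? ∘ rowₖ) (allFin k))
        ≡⟨ ≡.cong (map (Prod.map suc suc)) (filter-concatMap ordered? rowₖ (allFin k)) ⟨
      map (Prod.map suc suc) (pairsLt F k)
        ∎
      where
      rowₖ : Fin k → List (Fin k × Fin k)
      rowₖ a = map (a ,_) (allFin k)
      laterRow : ∀ a → filter ordered? (row (suc a)) ≡ map (Prod.map suc suc) (filter ordered? (rowₖ a))
      laterRow a = ≡.trans (≡.cong (filter ordered?) (≡.trans (Listₚ.map-tabulate suc (suc a ,_)) (≡.sym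
                     (≡.trans (≡.cong (map (Prod.map suc suc)) (Listₚ.map-tabulate id (a ,_))) (Listₚ.map-tabulate (a ,_) (Prod.map suc suc))))))
                     (filter-map-comm ordered? ordered? (λ _ → ≡.refl) (rowₖ a))

  avoids : ∀ {k m} → Fin m → (Fin k → Fin m) → Bool
  avoids i f = allOf (λ b → not ⌊ i ≟ f b ⌋)

  avoids-cong : ∀ {k m} (i : Fin m) {f g : Fin k → Fin m} → f ≗ g → avoids i f ≡ avoids i g
  avoids-cong {zero}  i f≗g = ≡.refl
  avoids-cong {suc k} i f≗g = ≡.cong₂ (λ x b → not ⌊ i ≟ x ⌋ ∧ b) (f≗g zero) (avoids-cong i (f≗g ∘ suc))

  avoids⇒≢ : ∀ {k m} (i : Fin m) (f : Fin k → Fin m) → avoids i f ≡ true → ∀ b → i ≢ f b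
  avoids⇒≢ i f avoids≡true b i≡fb =
    contradiction (≡.trans (≡.sym (≡.cong not (isYes-true (i ≟ f b) i≡fb))) (allOf-true _ avoids≡true b)) λ ()

  avoids-punchIn : ∀ {k m} (i : Fin (suc m)) (g : Fin k → Fin m) → avoids i (punchIn i ∘ g) ≡ true
  avoids-punchIn {zero}  i g = ≡.refl
  avoids-punchIn {suc k} i g =
    ≡.cong₂ (λ x y → not x ∧ y) (isYes-false (i ≟ punchIn i (g zero)) (Finₚ.punchInᵢ≢i i (g zero) ∘ ≡.sym)) (avoids-punchIn i (g ∘ suc))

  inverted? : ∀ {k m} (σ : Fin k → Fin m) (p : Fin k × Fin k) → Dec (toℕ (σ (proj₂ p)) < toℕ (σ (proj₁ p)))
  inverted? σ p = toℕ (σ (proj₂ p)) ℕ.<? toℕ (σ (proj₁ p))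

  isInjective-suc : ∀ {k m} (σ : Fin (suc k) → Fin m) →
                    isInjective F σ ≡ avoids (σ zero) (σ ∘ suc) ∧ isInjective F (σ ∘ suc)
  isInjective-suc {k} σ = begin
    isInjective F σ
      ≡⟨ ≡.cong (foldr step true) (pairsLt-suc k) ⟩
    foldr step true (tabulate (λ b → zero , suc b) ++ map (Prod.map suc suc) (pairsLt F k))
      ≡⟨ Listₚ.foldr-++ step true (tabulate (λ b → zero , suc b)) _ ⟩
    foldr step (foldr step true (map (Prod.map suc suc) (pairsLt F k))) (tabulate (λ b → zero , suc b))
      ≡⟨ ≡.cong (λ z → foldr step z (tabulate (λ b → zero , suc b))) (Listₚ.foldr-map step (Prod.map suc suc) true (pairsLt F k)) ⟩
    foldr step (isInjective F (σ ∘ suc)) (tabulate (λ b → zero , suc b))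
      ≡⟨ foldr-∧-tabulate (λ p → not ⌊ σ (proj₁ p) ≟ σ (proj₂ p) ⌋) (λ b → zero , suc b) _ ⟩
    avoids (σ zero) (σ ∘ suc) ∧ isInjective F (σ ∘ suc)
      ∎
    where
    open ≡.≡-Reasoning
    step : Fin (suc k) × Fin (suc k) → Bool → Bool
    step p r = not ⌊ σ (proj₁ p) ≟ σ (proj₂ p) ⌋ ∧ r

  inversions-suc : ∀ {k m} (σ : Fin (suc k) → Fin m) →
                   inversions F σ ≡ count (λ b → toℕ (σ (suc b)) ℕ.<ᵇ toℕ (σ zero)) ℕ.+ inversions F (σ ∘ suc)
  inversions-suc {k} σ = begin
    inversions F σ
      ≡⟨ ≡.cong (length ∘ filter (inverted? σ)) (pairsLt-suc k) ⟩
    length (filter (inverted? σ) (tabulate (λ b → zero , suc b) ++ map (Prod.map suc suc) (pairsLt F k)))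
      ≡⟨ ≡.cong length (Listₚ.filter-++ (inverted? σ) (tabulate (λ b → zero , suc b)) _) ⟩
    length (filter (inverted? σ) (tabulate (λ b → zero , suc b)) ++ filter (inverted? σ) (map (Prod.map suc suc) (pairsLt F k)))
      ≡⟨ Listₚ.length-++ (filter (inverted? σ) (tabulate (λ b → zero , suc b))) ⟩
    length (filter (inverted? σ) (tabulate (λ b → zero , suc b))) ℕ.+ length (filter (inverted? σ) (map (Prod.map suc suc) (pairsLt F k)))
      ≡⟨ ≡.cong₂ ℕ._+_ (length-filter-tabulate (inverted? σ) (λ b → zero , suc b))
                       (length-filter-map (inverted? σ) (inverted? (σ ∘ suc)) (λ _ → ≡.refl) (pairsLt F k)) ⟩
    count (λ b → toℕ (σ (suc b)) ℕ.<ᵇ toℕ (σ zero)) ℕ.+ inversions F (σ ∘ suc)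
      ∎
    where open ≡.≡-Reasoning

  isInjective-cong : ∀ {k m} {σ τ : Fin k → Fin m} → σ ≗ τ → isInjective F σ ≡ isInjective F τ
  isInjective-cong {k} σ≗τ = Listₚ.foldr-cong
    (λ p r → ≡.cong₂ (λ x y → not ⌊ x ≟ y ⌋ ∧ r) (σ≗τ (proj₁ p)) (σ≗τ (proj₂ p))) ≡.refl (pairsLt F k)

  inversions-cong : ∀ {k m} {σ τ : Fin k → Fin m} → σ ≗ τ → inversions F σ ≡ inversions F τ
  inversions-cong {k} {σ = σ} {τ} σ≗τ = ≡.cong length (filter-does-cong (inverted? σ) (inverted? τ)
    (λ p → ≡.cong₂ (λ x y → toℕ x ℕ.<ᵇ toℕ y) (σ≗τ (proj₂ p)) (σ≗τ (proj₁ p))) (pairsLt F k))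

  shiftExp-cong : ∀ {k m} {σ τ : Fin k → Fin m} → σ ≗ τ → shiftExp F σ ≡ shiftExp F τ
  shiftExp-cong {k} σ≗τ = ≡.cong (λ xs → foldr ℕ._+_ 0 xs ℕ.∸ sumℕ F {k} toℕ) (Listₚ.map-cong (≡.cong toℕ ∘ σ≗τ) (allFin k))

  isInjective-punchIn : ∀ {k m} (i : Fin (suc m)) (g : Fin k → Fin m) → isInjective F (punchIn i ∘ g) ≡ isInjective F g
  isInjective-punchIn {k} i g = Listₚ.foldr-cong
    (λ p r → ≡.cong (λ b → not b ∧ r) (punchIn-≟ i (g (proj₁ p)) (g (proj₂ p)))) ≡.refl (pairsLt F k)

  inversions-punchIn : ∀ {k m} (i : Fin (suc m)) (g : Fin k → Fin m) → inversions F (punchIn i ∘ g) ≡ inversions F g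
  inversions-punchIn {k} i g = ≡.cong length (filter-does-cong (inverted? (punchIn i ∘ g)) (inverted? g)
    (λ p → punchIn-<ᵇ i (g (proj₂ p)) (g (proj₁ p))) (pairsLt F k))

  injective-tail : ∀ {k m} (g : Fin (suc k) → Fin (suc m)) → isInjective F g ≡ true →
                   Σ (Fin k → Fin m) λ h → isInjective F h ≡ true × (∀ b → punchIn (g zero) (h b) ≡ g (suc b))
  injective-tail {k} {m} g g-inj = h , h-inj , punchIn-h
    where
    head-fresh : avoids (g zero) (g ∘ suc) ≡ true
    head-fresh = ∧-conicalˡ _ _ (≡.trans (≡.sym (isInjective-suc g)) g-inj)
    tail-inj : isInjective F (g ∘ suc) ≡ true
    tail-inj = ∧-conicalʳ _ _ (≡.trans (≡.sym (isInjective-suc g)) g-inj)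
    h : Fin k → Fin m
    h b = punchOut (avoids⇒≢ (g zero) (g ∘ suc) head-fresh b)
    punchIn-h : ∀ b → punchIn (g zero) (h b) ≡ g (suc b)
    punchIn-h b = Finₚ.punchIn-punchOut _
    h-inj : isInjective F h ≡ true
    h-inj = ≡.trans (≡.sym (isInjective-punchIn (g zero) h)) (≡.trans (isInjective-cong punchIn-h) tail-inj)

  count-below-injective : ∀ {k m} (g : Fin k → Fin m) → isInjective F g ≡ true →
                          ∀ x → count (λ b → toℕ (g b) ℕ.<ᵇ x) ≤ x
  count-below-injective {zero}          g g-inj x = z≤n
  count-below-injective {suc k} {zero}  g g-inj x with () ← g zero
  count-below-injective {suc k} {suc m} g g-inj x with injective-tail g g-inj | toℕ (g zero) ℕ.<? x
  ... | h , h-inj , punchIn-h | yes (s≤s j≤x′) = begin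
    count (λ b → toℕ (g b) ℕ.<ᵇ x)
      ≡⟨ ≡.cong₂ ℕ._+_ (≡.cong (λ t → if t then 1 else 0) (dec-true (toℕ (g zero) ℕ.<? x) (s≤s j≤x′)))
                       (count-cong λ b → ≡.trans (≡.cong (λ y → toℕ y ℕ.<ᵇ x) (≡.sym (punchIn-h b))) (punchIn-<ᵇ-above (g zero) (h b) j≤x′)) ⟩
    suc (count (λ b → toℕ (h b) ℕ.<ᵇ ℕ.pred x))
      ≤⟨ s≤s (count-below-injective h h-inj (ℕ.pred x)) ⟩
    x ∎
    where open ℕₚ.≤-Reasoning
  ... | h , h-inj , punchIn-h | no j≮x = begin
    count (λ b → toℕ (g b) ℕ.<ᵇ x)
      ≡⟨ ≡.cong₂ ℕ._+_ (≡.cong (λ t → if t then 1 else 0) (dec-false (toℕ (g zero) ℕ.<? x) j≮x))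
                       (count-cong λ b → ≡.trans (≡.cong (λ y → toℕ y ℕ.<ᵇ x) (≡.sym (punchIn-h b))) (punchIn-<ᵇ-below (g zero) (h b) (ℕₚ.≮⇒≥ j≮x))) ⟩
    count (λ b → toℕ (h b) ℕ.<ᵇ x)
      ≤⟨ count-below-injective h h-inj x ⟩
    x ∎
    where open ℕₚ.≤-Reasoning

  ∑toℕ≤∑toℕ-injective : ∀ {k m} (g : Fin k → Fin m) → isInjective F g ≡ true → ∑ℕ {k} toℕ ≤ ∑ℕ (toℕ ∘ g)
  ∑toℕ≤∑toℕ-injective {zero}          g g-inj = z≤n
  ∑toℕ≤∑toℕ-injective {suc k} {zero}  g g-inj with () ← g zero
  ∑toℕ≤∑toℕ-injective {suc k} {suc m} g g-inj with injective-tail g g-inj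
  ... | h , h-inj , punchIn-h = begin
    ∑ℕ {suc k} toℕ
      ≡⟨ ∑ℕ-suc {k} toℕ ⟩
    ∑ℕ {k} toℕ ℕ.+ k
      ≡⟨ ≡.cong (∑ℕ {k} toℕ ℕ.+_) (≡.sym (count-complement below)) ⟩
    ∑ℕ {k} toℕ ℕ.+ (count below ℕ.+ count (not ∘ below))
      ≤⟨ ℕₚ.+-monoʳ-≤ (∑ℕ {k} toℕ) (ℕₚ.+-monoˡ-≤ _ (count-below-injective h h-inj (toℕ j))) ⟩
    ∑ℕ {k} toℕ ℕ.+ (toℕ j ℕ.+ count (not ∘ below))
      ≤⟨ ℕₚ.+-monoˡ-≤ _ (∑toℕ≤∑toℕ-injective h h-inj) ⟩
    ∑ℕ (toℕ ∘ h) ℕ.+ (toℕ j ℕ.+ count (not ∘ below))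
      ≡⟨ reorder (∑ℕ (toℕ ∘ h)) (toℕ j) _ ⟩
    toℕ j ℕ.+ (∑ℕ (toℕ ∘ h) ℕ.+ count (not ∘ below))
      ≡⟨ ≡.cong (toℕ j ℕ.+_) (≡.sym (∑toℕ-punchIn j h)) ⟩
    toℕ j ℕ.+ ∑ℕ (λ b → toℕ (punchIn j (h b)))
      ≡⟨ ≡.cong (toℕ j ℕ.+_) (∑ℕ-cong (≡.cong toℕ ∘ punchIn-h)) ⟩
    ∑ℕ (toℕ ∘ g) ∎
    where
    open ℕₚ.≤-Reasoning
    j : Fin (suc m)
    j = g zero
    below : Fin k → Bool
    below b = toℕ (h b) ℕ.<ᵇ toℕ j
    reorder : ∀ a b c → a ℕ.+ (b ℕ.+ c) ≡ b ℕ.+ (a ℕ.+ c)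
    reorder = solve-∀

module CullisDeterminant {c ℓ : Level} (F : Field c ℓ) where
  open Field F hiding (zero)
  open import Algebra.Properties.Ring ring using (-‿involutive; -‿distribˡ-*; -‿distribʳ-*)
  open import Algebra.Properties.Semiring.Sum semiring
    using (sum; sum-cong-≋; ∑-distrib-+; ∑-comm; *-distribˡ-sum; sum-init-last; sum-remove; sum-replicate-zero; sum-cong-≗)
  open import Algebra.Properties.CommutativeSemigroup *-commutativeSemigroup using (interchange)
  open import Algebra.Properties.Group +-group using (inverseˡ-unique)
  open import Relation.Binary.Reasoning.Setoid setoid
  open Injections F

  -x*-y≈x*y : ∀ x y → (- x) * (- y) ≈ x * y
  -x*-y≈x*y x y = begin
    (- x) * (- y)   ≈⟨ -‿distribˡ-* x (- y) ⟨
    - (x * (- y))   ≈⟨ -‿cong (-‿distribʳ-* x y) ⟨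
    - (- (x * y))   ≈⟨ -‿involutive (x * y) ⟩
    x * y           ∎

  negOnePow-+ : ∀ a b → negOnePow F (a ℕ.+ b) ≈ negOnePow F a * negOnePow F b
  negOnePow-+ zero    b = sym (*-identityˡ _)
  negOnePow-+ (suc a) b = trans (-‿cong (negOnePow-+ a b)) (-‿distribˡ-* _ _)

  negOnePow-square : ∀ a → negOnePow F a * negOnePow F a ≈ 1#
  negOnePow-square zero    = *-identityˡ 1#
  negOnePow-square (suc a) = trans (-x*-y≈x*y _ _) (negOnePow-square a)

  negOnePow-+-double : ∀ a b → negOnePow F (a ℕ.+ (b ℕ.+ b)) ≈ negOnePow F a
  negOnePow-+-double a b = begin
    negOnePow F (a ℕ.+ (b ℕ.+ b))                      ≈⟨ negOnePow-+ a (b ℕ.+ b) ⟩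
    negOnePow F a * negOnePow F (b ℕ.+ b)              ≈⟨ *-congˡ (negOnePow-+ b b) ⟩
    negOnePow F a * (negOnePow F b * negOnePow F b)    ≈⟨ *-congˡ (negOnePow-square b) ⟩
    negOnePow F a * 1#                                 ≈⟨ *-identityʳ _ ⟩
    negOnePow F a                                      ∎

  negOnePow-∸ : ∀ {a b} → b ≤ a → negOnePow F (a ℕ.∸ b) ≈ negOnePow F (a ℕ.+ b)
  negOnePow-∸ {a} {b} b≤a = sym (begin
    negOnePow F (a ℕ.+ b)                      ≡⟨ ≡.cong (λ x → negOnePow F (x ℕ.+ b)) (ℕₚ.m+[n∸m]≡n b≤a) ⟨
    negOnePow F (b ℕ.+ d ℕ.+ b)                ≡⟨ ≡.cong (negOnePow F) (reorder b d) ⟩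
    negOnePow F (d ℕ.+ (b ℕ.+ b))              ≈⟨ negOnePow-+-double d b ⟩
    negOnePow F d                              ∎)
    where
    d : ℕ
    d = a ℕ.∸ b
    reorder : ∀ x y → x ℕ.+ y ℕ.+ x ≡ y ℕ.+ (x ℕ.+ x)
    reorder = solve-∀

  ε : ∀ {m} → Fin m → Carrier
  ε i = negOnePow F (toℕ i)

  sum-negOnePow : ∀ n → n % 2 ≡ 0 → sum {n} ε ≈ 0#
  sum-negOnePow zero          _      = refl
  sum-negOnePow (suc (suc n)) n-even = begin
    1# + (- 1# + sum {n} (λ r → - - ε r))   ≈⟨ +-congˡ (+-congˡ (sum-cong-≋ {n} (-‿involutive ∘ ε))) ⟩
    1# + (- 1# + sum {n} ε)                 ≈⟨ +-congˡ (+-congˡ (sum-negOnePow n n-even)) ⟩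
    1# + (- 1# + 0#)                        ≈⟨ +-congˡ (+-identityʳ _) ⟩
    1# + - 1#                               ≈⟨ -‿inverseʳ 1# ⟩
    0#                                      ∎

  negOnePow-swapIndex : ∀ {n} (t : Fin (suc (suc n))) (u : Fin (suc n)) →
    ε (punchIn t u) * ε (swapIndex t u) ≈ - (ε t * ε u)
  negOnePow-swapIndex         zero    u       = trans (*-identityʳ _) (-‿cong (sym (*-identityˡ _)))
  negOnePow-swapIndex         (suc t) zero    = trans (*-identityˡ _) (trans (sym (-‿involutive _)) (-‿cong (sym (*-identityʳ _))))
  negOnePow-swapIndex {suc n} (suc t) (suc u) = trans (-x*-y≈x*y _ _) (trans (negOnePow-swapIndex t u) (-‿cong (sym (-x*-y≈x*y _ _))))

  sum-punchIn : ∀ {n} (i : Fin (suc n)) (f : Fin (suc n) → Carrier) → f i ≈ 0# → sum f ≈ sum (f ∘ punchIn i)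
  sum-punchIn i f fi≈0 = trans (sum-remove {i = i} f) (trans (+-congʳ fi≈0) (+-identityˡ _))

  sum-zero : ∀ {n} (f : Fin n → Carrier) → (∀ i → f i ≈ 0#) → sum f ≈ 0#
  sum-zero {n} f f≈0 = trans (sum-cong-≋ f≈0) (sum-replicate-zero n)

  sum-offDiagonal : ∀ {n} (H : Fin (suc n) → Fin (suc n) → Carrier) → (∀ r → H r r ≈ 0#) →
                    sum (λ r → sum (λ s → H r (punchIn r s))) ≈ sum (λ t → sum (λ u → H (punchIn t u) t))
  sum-offDiagonal H H-diag = begin
    sum (λ r → sum (λ s → H r (punchIn r s)))    ≈⟨ sum-cong-≋ (λ r → sum-punchIn r (H r) (H-diag r)) ⟨
    sum (λ r → sum (λ t → H r t))                ≈⟨ ∑-comm H ⟩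
    sum (λ t → sum (λ r → H r t))                ≈⟨ sum-cong-≋ (λ t → sum-punchIn t (λ r → H r t) (H-diag t)) ⟩
    sum (λ t → sum (λ u → H (punchIn t u) t))    ∎

  listSum : (A → Carrier) → List A → Carrier
  listSum f xs = foldr _+_ 0# (map f xs)

  listSum-cong : ∀ {f g : A → Carrier} → (∀ x → f x ≈ g x) → ∀ xs → listSum f xs ≈ listSum g xs
  listSum-cong f≈g []       = refl
  listSum-cong f≈g (x ∷ xs) = +-cong (f≈g x) (listSum-cong f≈g xs)

  listSum-zero : ∀ {f : A → Carrier} → (∀ x → f x ≈ 0#) → ∀ xs → listSum f xs ≈ 0#
  listSum-zero f≈0 []       = refl
  listSum-zero f≈0 (x ∷ xs) = trans (+-cong (f≈0 x) (listSum-zero f≈0 xs)) (+-identityˡ 0#)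

  listSum-++ : ∀ (f : A → Carrier) xs ys → listSum f (xs ++ ys) ≈ listSum f xs + listSum f ys
  listSum-++ f []       ys = sym (+-identityˡ _)
  listSum-++ f (x ∷ xs) ys = trans (+-congˡ (listSum-++ f xs ys)) (sym (+-assoc _ _ _))

  *-distribˡ-listSum : ∀ a (f : A → Carrier) xs → a * listSum f xs ≈ listSum (λ x → a * f x) xs
  *-distribˡ-listSum a f []       = zeroʳ a
  *-distribˡ-listSum a f (x ∷ xs) = trans (distribˡ a _ _) (+-congˡ (*-distribˡ-listSum a f xs))

  listSum-filter : ∀ {p} {P : A → Set p} (P? : ∀ x → Dec (P x)) (f : A → Carrier) xs →
                   listSum f (filter P? xs) ≈ listSum (λ x → if does (P? x) then f x else 0#) xs
  listSum-filter P? f []       = refl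
  listSum-filter P? f (x ∷ xs) with does (P? x)
  ... | true  = +-congˡ (listSum-filter P? f xs)
  ... | false = trans (listSum-filter P? f xs) (sym (+-identityˡ _))

  listSum-map : ∀ (f : B → Carrier) (g : A → B) xs → listSum f (map g xs) ≡ listSum (f ∘ g) xs
  listSum-map f g xs = ≡.cong (foldr _+_ 0#) (≡.sym (Listₚ.map-∘ xs))

  listSum-concatMap : ∀ (f : B → Carrier) (g : A → List B) xs →
                      listSum f (concatMap g xs) ≈ listSum (λ x → listSum f (g x)) xs
  listSum-concatMap f g []       = refl
  listSum-concatMap f g (x ∷ xs) = trans (listSum-++ f (g x) (concatMap g xs)) (+-congˡ (listSum-concatMap f g xs))

  listSum-tabulate : ∀ {n} (f : A → Carrier) (g : Fin n → A) → listSum f (tabulate g) ≡ sum (f ∘ g)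
  listSum-tabulate {n = zero}  f g = ≡.refl
  listSum-tabulate {n = suc n} f g = ≡.cong (f (g zero) +_) (listSum-tabulate f (g ∘ suc))

  sumMaps : ∀ k m → ((Fin k → Fin m) → Carrier) → Carrier
  sumMaps k m G = listSum G (allFuns F k m)

  -- allFuns builds its maps with pattern-matching lambdas, equal to i ∷ᵛ f only pointwise.
  Extensional : ∀ {k m} → ((Fin k → Fin m) → Carrier) → Set ℓ
  Extensional G = ∀ {σ τ} → σ ≗ τ → G σ ≈ G τ

  sumMaps-suc : ∀ {k m} (G : (Fin (suc k) → Fin m) → Carrier) → Extensional G →
                sumMaps (suc k) m G ≈ sum (λ i → sumMaps k m (λ f → G (i ∷ᵛ f)))
  sumMaps-suc {k} {m} G G-ext =
    trans (listSum-concatMap G _ (allFin m)) (trans (reflexive (listSum-tabulate {n = m} _ id)) (sum-cong-≋ {m} λ i →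
      trans (reflexive (listSum-map G _ (allFuns F k m)))
            (listSum-cong (λ f → G-ext λ { zero → ≡.refl ; (suc a) → ≡.refl }) (allFuns F k m))))

  sumMaps-avoiding : ∀ {k m} (i : Fin (suc m)) (G : (Fin k → Fin (suc m)) → Carrier) → Extensional G →
                     sumMaps k (suc m) (λ f → if avoids i f then G f else 0#) ≈ sumMaps k m (λ g → G (punchIn i ∘ g))
  sumMaps-avoiding {zero}  i G G-ext = +-congʳ (G-ext λ ())
  sumMaps-avoiding {suc k} {m} i G G-ext = begin
    sumMaps (suc k) (suc m) (λ f → if avoids i f then G f else 0#)
      ≈⟨ sumMaps-suc _ (λ {σ} {τ} σ≗τ → if-cong (avoids-cong i σ≗τ) (G-ext σ≗τ)) ⟩
    sum (λ a → sumMaps k (suc m) (λ f → if not ⌊ i ≟ a ⌋ ∧ avoids i f then G (a ∷ᵛ f) else 0#))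
      ≈⟨ sum-punchIn i (λ a → sumMaps k (suc m) (λ f → if not ⌊ i ≟ a ⌋ ∧ avoids i f then G (a ∷ᵛ f) else 0#))
           (listSum-zero (λ f → reflexive (≡.cong (λ b → if not b ∧ avoids i f then G (i ∷ᵛ f) else 0#) (isYes-true (i ≟ i) ≡.refl))) (allFuns F k (suc m))) ⟩
    sum (λ b → sumMaps k (suc m) (λ f → if not ⌊ i ≟ punchIn i b ⌋ ∧ avoids i f then G (punchIn i b ∷ᵛ f) else 0#))
      ≡⟨ sum-cong-≗ (λ b → ≡.cong (λ x → sumMaps k (suc m) (λ f → if not x ∧ avoids i f then G (punchIn i b ∷ᵛ f) else 0#))
                                  (isYes-false (i ≟ punchIn i b) (Finₚ.punchInᵢ≢i i b ∘ ≡.sym))) ⟩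
    sum (λ b → sumMaps k (suc m) (λ f → if avoids i f then G (punchIn i b ∷ᵛ f) else 0#))
      ≈⟨ sum-cong-≋ (λ b → sumMaps-avoiding i (λ f → G (punchIn i b ∷ᵛ f)) (λ σ≗τ → G-ext λ { zero → ≡.refl ; (suc a) → σ≗τ a })) ⟩
    sum (λ b → sumMaps k m (λ g → G (punchIn i b ∷ᵛ (punchIn i ∘ g))))
      ≈⟨ sum-cong-≋ (λ b → listSum-cong (λ g → G-ext {punchIn i ∘ (b ∷ᵛ g)} λ { zero → ≡.refl ; (suc a) → ≡.refl }) (allFuns F k m)) ⟨
    sum (λ b → sumMaps k m (λ g → G (punchIn i ∘ (b ∷ᵛ g))))
      ≈⟨ sumMaps-suc (λ g → G (punchIn i ∘ g)) (λ σ≗τ → G-ext (≡.cong (punchIn i) ∘ σ≗τ)) ⟨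
    sumMaps (suc k) m (λ g → G (punchIn i ∘ g))
      ∎
    where
    if-cong : ∀ {b b' x y} → b ≡ b' → x ≈ y → (if b then x else 0#) ≈ (if b' then y else 0#)
    if-cong {true}  ≡.refl x≈y = x≈y
    if-cong {false} ≡.refl x≈y = refl

  -- shiftExp is a truncated difference; it is a true one because Σ α ≤ Σ σ α for injective σ.
  sgnCullis-injective : ∀ {k m} (σ : Fin k → Fin m) → isInjective F σ ≡ true →
                        sgnCullis F σ ≈ negOnePow F (inversions F σ ℕ.+ (∑ℕ (toℕ ∘ σ) ℕ.+ ∑ℕ {k} toℕ))
  sgnCullis-injective {k} σ σ-inj = begin
    negOnePow F (inversions F σ) * negOnePow F (shiftExp F σ)
      ≡⟨ ≡.cong (λ e → negOnePow F (inversions F σ) * negOnePow F e) (≡.cong₂ ℕ._∸_ (∑ℕ-tabulate {k = k} (toℕ ∘ σ) id) (∑ℕ-tabulate {k = k} toℕ id)) ⟩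
    negOnePow F (inversions F σ) * negOnePow F (∑ℕ (toℕ ∘ σ) ℕ.∸ ∑ℕ {k} toℕ)
      ≈⟨ *-congˡ (negOnePow-∸ (∑toℕ≤∑toℕ-injective σ σ-inj)) ⟩
    negOnePow F (inversions F σ) * negOnePow F (∑ℕ (toℕ ∘ σ) ℕ.+ ∑ℕ {k} toℕ)
      ≈⟨ negOnePow-+ (inversions F σ) _ ⟨
    negOnePow F (inversions F σ ℕ.+ (∑ℕ (toℕ ∘ σ) ℕ.+ ∑ℕ {k} toℕ))
      ∎

  sgnCullis-punchIn : ∀ {k m} (i : Fin (suc m)) (g : Fin k → Fin m) → isInjective F g ≡ true →
                      sgnCullis F (i ∷ᵛ (punchIn i ∘ g)) ≈ ε i * sgnCullis F g
  sgnCullis-punchIn {k} {m} i g g-inj = begin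
    sgnCullis F σ
      ≈⟨ sgnCullis-injective σ σ-inj ⟩
    negOnePow F (inversions F σ ℕ.+ (∑ℕ (toℕ ∘ σ) ℕ.+ ∑ℕ {suc k} toℕ))
      ≡⟨ ≡.cong (negOnePow F) (≡.cong₂ ℕ._+_ inversions-σ (≡.cong₂ ℕ._+_ ∑σ-split ∑id-split)) ⟩
    negOnePow F ((lo ℕ.+ inversions F g) ℕ.+ ((toℕ i ℕ.+ (∑g ℕ.+ hi)) ℕ.+ (∑k ℕ.+ (lo ℕ.+ hi))))
      ≡⟨ ≡.cong (negOnePow F) (reorder lo (inversions F g) (toℕ i) ∑g hi ∑k) ⟩
    negOnePow F ((toℕ i ℕ.+ (inversions F g ℕ.+ (∑g ℕ.+ ∑k))) ℕ.+ ((lo ℕ.+ hi) ℕ.+ (lo ℕ.+ hi)))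
      ≈⟨ negOnePow-+-double (toℕ i ℕ.+ (inversions F g ℕ.+ (∑g ℕ.+ ∑k))) (lo ℕ.+ hi) ⟩
    negOnePow F (toℕ i ℕ.+ (inversions F g ℕ.+ (∑g ℕ.+ ∑k)))
      ≈⟨ negOnePow-+ (toℕ i) _ ⟩
    ε i * negOnePow F (inversions F g ℕ.+ (∑g ℕ.+ ∑k))
      ≈⟨ *-congˡ (sgnCullis-injective g g-inj) ⟨
    ε i * sgnCullis F g
      ∎
    where
    σ : Fin (suc k) → Fin (suc m)
    σ = i ∷ᵛ (punchIn i ∘ g)
    below : Fin k → Bool
    below b = toℕ (g b) ℕ.<ᵇ toℕ i
    lo hi ∑g ∑k : ℕ
    lo = count below
    hi = count (not ∘ below)
    ∑g = ∑ℕ (toℕ ∘ g)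
    ∑k = ∑ℕ {k} toℕ
    σ-inj : isInjective F σ ≡ true
    σ-inj = ≡.trans (isInjective-suc σ) (≡.cong₂ _∧_ (avoids-punchIn i g) (≡.trans (isInjective-punchIn i g) g-inj))
    inversions-σ : inversions F σ ≡ lo ℕ.+ inversions F g
    inversions-σ = ≡.trans (inversions-suc σ)
      (≡.cong₂ ℕ._+_ (count-cong λ b → punchIn-<ᵇ-below i (g b) ℕₚ.≤-refl) (inversions-punchIn i g))
    ∑σ-split : ∑ℕ (toℕ ∘ σ) ≡ toℕ i ℕ.+ (∑g ℕ.+ hi)
    ∑σ-split = ≡.cong (toℕ i ℕ.+_) (∑toℕ-punchIn i g)
    ∑id-split : ∑ℕ {suc k} toℕ ≡ ∑k ℕ.+ (lo ℕ.+ hi)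
    ∑id-split = ≡.trans (∑ℕ-suc {k} toℕ) (≡.cong (∑k ℕ.+_) (≡.sym (count-complement below)))
    reorder : ∀ l v i a h b → (l ℕ.+ v) ℕ.+ ((i ℕ.+ (a ℕ.+ h)) ℕ.+ (b ℕ.+ (l ℕ.+ h)))
                             ≡ (i ℕ.+ (v ℕ.+ (a ℕ.+ b))) ℕ.+ ((l ℕ.+ h) ℕ.+ (l ℕ.+ h))
    reorder = solve-∀

  sgnCullis-cong : ∀ {k m} {σ τ : Fin k → Fin m} → σ ≗ τ → sgnCullis F σ ≡ sgnCullis F τ
  sgnCullis-cong σ≗τ = ≡.cong₂ (λ a b → negOnePow F a * negOnePow F b) (inversions-cong σ≗τ) (shiftExp-cong σ≗τ)

  prodF-suc : ∀ {k} (f : Fin (suc k) → Carrier) → prodF F f ≡ f zero * prodF F (f ∘ suc)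
  prodF-suc f = ≡.cong (λ xs → f zero * foldr _*_ 1# xs)
    (≡.trans (Listₚ.map-tabulate suc f) (≡.sym (Listₚ.map-tabulate id (f ∘ suc))))

  prodF-cong : ∀ {k} {f g : Fin k → Carrier} → (∀ j → f j ≈ g j) → prodF F f ≈ prodF F g
  prodF-cong {zero}          f≈g = refl
  prodF-cong {suc k} {f} {g} f≈g = begin
    prodF F f                  ≡⟨ prodF-suc f ⟩
    f zero * prodF F (f ∘ suc) ≈⟨ *-cong (f≈g zero) (prodF-cong (f≈g ∘ suc)) ⟩
    g zero * prodF F (g ∘ suc) ≡⟨ prodF-suc g ⟨
    prodF F g                  ∎

  cullisTerm : ∀ {m k} → Mat F m k → (Fin k → Fin m) → Carrier
  cullisTerm X σ = if isInjective F σ then sgnCullis F σ * prodF F (λ j → X (σ j) j) else 0#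

  cullisTerm-ext : ∀ {m k} (X : Mat F m k) → Extensional (cullisTerm X)
  cullisTerm-ext X {σ} {τ} σ≗τ with isInjective F σ | isInjective F τ | isInjective-cong σ≗τ
  ... | true  | .true  | ≡.refl = *-cong (reflexive (sgnCullis-cong σ≗τ)) (prodF-cong λ j → reflexive (≡.cong (λ r → X r j) (σ≗τ j)))
  ... | false | .false | ≡.refl = refl

  detC-sumMaps : ∀ {m k} (X : Mat F m k) → detC F X ≈ sumMaps k m (cullisTerm X)
  detC-sumMaps {m} {k} X = trans (listSum-filter _ _ (allFuns F k m)) (listSum-cong (does-≟-true ∘ isInjective F) (allFuns F k m))
    where
    does-≟-true : ∀ {x} b → (if does (b Bool.≟ true) then x else 0#) ≈ (if b then x else 0#)
    does-≟-true true  = refl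
    does-≟-true false = refl

  minor : ∀ {m k} → Fin (suc m) → Mat F (suc m) (suc k) → Mat F m k
  minor i X r j = X (punchIn i r) (suc j)

  cofactorTerm : ∀ {m k} → Mat F (suc m) (suc k) → Fin (suc m) → Carrier
  cofactorTerm X i = (ε i * X i zero) * detC F (minor i X)

  detC-expand : ∀ {m k} (X : Mat F (suc m) (suc k)) → detC F X ≈ sum (cofactorTerm X)
  detC-expand {m} {k} X = begin
    detC F X
      ≈⟨ detC-sumMaps X ⟩
    sumMaps (suc k) (suc m) (cullisTerm X)
      ≈⟨ sumMaps-suc (cullisTerm X) (cullisTerm-ext X) ⟩
    sum (λ i → sumMaps k (suc m) (λ f → cullisTerm X (i ∷ᵛ f)))
      ≈⟨ sum-cong-≋ expandRow ⟩
    sum (cofactorTerm X)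
      ∎
    where
    expandRow : ∀ i → sumMaps k (suc m) (λ f → cullisTerm X (i ∷ᵛ f)) ≈ cofactorTerm X i
    expandRow i = begin
      sumMaps k (suc m) (λ f → cullisTerm X (i ∷ᵛ f))
        ≈⟨ listSum-cong split (allFuns F k (suc m)) ⟩
      sumMaps k (suc m) (λ f → if avoids i f then G f else 0#)
        ≈⟨ sumMaps-avoiding i G G-ext ⟩
      sumMaps k m (λ g → G (punchIn i ∘ g))
        ≈⟨ listSum-cong factor (allFuns F k m) ⟩
      sumMaps k m (λ g → (ε i * X i zero) * cullisTerm (minor i X) g)
        ≈⟨ *-distribˡ-listSum _ (cullisTerm (minor i X)) (allFuns F k m) ⟨
      (ε i * X i zero) * sumMaps k m (cullisTerm (minor i X))
        ≈⟨ *-congˡ (detC-sumMaps (minor i X)) ⟨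
      (ε i * X i zero) * detC F (minor i X)
        ∎
      where
      G : (Fin k → Fin (suc m)) → Carrier
      G f = if isInjective F f then sgnCullis F (i ∷ᵛ f) * (X i zero * prodF F (λ j → X (f j) (suc j))) else 0#
      G-ext : Extensional G
      G-ext {f} {f′} f≗f′ with isInjective F f | isInjective F f′ | isInjective-cong f≗f′
      ... | true  | .true  | ≡.refl = *-cong (reflexive (sgnCullis-cong {σ = i ∷ᵛ f} {i ∷ᵛ f′} λ { zero → ≡.refl ; (suc j) → f≗f′ j }))
                                             (*-congˡ (prodF-cong λ j → reflexive (≡.cong (λ r → X r (suc j)) (f≗f′ j))))
      ... | false | .false | ≡.refl = refl
      split : ∀ f → cullisTerm X (i ∷ᵛ f) ≈ (if avoids i f then G f else 0#)
      split f rewrite isInjective-suc (i ∷ᵛ f) with avoids i f | isInjective F f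
      ... | true  | true  = *-congˡ (reflexive (prodF-suc (λ j → X ((i ∷ᵛ f) j) j)))
      ... | true  | false = refl
      ... | false | _     = refl
      factor : ∀ g → G (punchIn i ∘ g) ≈ (ε i * X i zero) * cullisTerm (minor i X) g
      factor g rewrite isInjective-punchIn i g with isInjective F g in g-inj
      ... | true  = trans (*-congʳ (sgnCullis-punchIn i g g-inj)) (interchange _ _ _ _)
      ... | false = sym (zeroʳ _)

  detC-cong : ∀ {m k} {X Y : Mat F m k} → _≈ᴹ_ F X Y → detC F X ≈ detC F Y
  detC-cong {m} {k} X≈Y = listSum-cong (λ σ → *-congˡ (prodF-cong λ j → X≈Y (σ j) j)) (injections F k m)

  detC-no-columns : ∀ {m} (X : Mat F m zero) → detC F X ≈ 1#
  detC-no-columns X = trans (+-identityʳ _) (trans (*-identityʳ _) (*-identityʳ _))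

  detC-zero-last-row : ∀ {n k} (Z : Mat F (suc n) k) → (∀ j → Z (fromℕ n) j ≈ 0#) → detC F Z ≈ detC F (Z ∘ inject₁)
  detC-zero-last-row {k = zero} Z _ = trans (detC-no-columns Z) (sym (detC-no-columns (Z ∘ inject₁)))
  detC-zero-last-row {zero} {suc k} Z last≈0 = begin
    detC F Z                                                       ≈⟨ detC-expand Z ⟩
    (1# * Z zero zero) * detC F (minor zero Z) + 0#                ≈⟨ +-identityʳ _ ⟩
    (1# * Z zero zero) * detC F (minor zero Z)                     ≈⟨ *-congʳ (*-congˡ (last≈0 zero)) ⟩
    (1# * 0#) * detC F (minor zero Z)                              ≈⟨ trans (*-congʳ (zeroʳ 1#)) (zeroˡ _) ⟩
    0#                                                             ∎
  detC-zero-last-row {suc n} {suc k} Z last≈0 = begin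
    detC F Z
      ≈⟨ detC-expand Z ⟩
    sum (cofactorTerm Z)
      ≈⟨ sum-init-last (cofactorTerm Z) ⟩
    sum (λ r → cofactorTerm Z (inject₁ r)) + cofactorTerm Z (fromℕ (suc n))
      ≈⟨ +-cong (sum-cong-≋ initTerm) lastTerm ⟩
    sum (cofactorTerm (Z ∘ inject₁)) + 0#
      ≈⟨ +-identityʳ _ ⟩
    sum (cofactorTerm (Z ∘ inject₁))
      ≈⟨ detC-expand (Z ∘ inject₁) ⟨
    detC F (Z ∘ inject₁)
      ∎
    where
    lastTerm : cofactorTerm Z (fromℕ (suc n)) ≈ 0#
    lastTerm = trans (*-congʳ (trans (*-congˡ (last≈0 zero)) (zeroʳ _))) (zeroˡ _)
    initTerm : ∀ r → cofactorTerm Z (inject₁ r) ≈ cofactorTerm (Z ∘ inject₁) r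
    initTerm r = *-cong (*-congʳ (reflexive (≡.cong (negOnePow F) (Finₚ.toℕ-inject₁ r)))) (begin
      detC F (minor (inject₁ r) Z)
        ≈⟨ detC-zero-last-row (minor (inject₁ r) Z) (λ j → trans (reflexive (≡.cong (λ i → Z i (suc j)) (punchIn-inject₁-last r))) (last≈0 (suc j))) ⟩
      detC F (minor (inject₁ r) Z ∘ inject₁)
        ≈⟨ detC-cong {X = minor (inject₁ r) Z ∘ inject₁} {minor r (Z ∘ inject₁)} (λ s j → reflexive (≡.cong (λ i → Z i (suc j)) (punchIn-inject₁ r s))) ⟩
      detC F (minor r (Z ∘ inject₁))
        ∎)

  Lplus-inject₁ : ∀ {n k} (Y : Mat F n k) r j → Lplus F Y (inject₁ r) j ≡ Y r j
  Lplus-inject₁ {suc n} Y zero    j = ≡.refl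
  Lplus-inject₁ {suc n} Y (suc r) j = Lplus-inject₁ (Y ∘ suc) r j

  Lplus-last : ∀ {n k} (Y : Mat F n k) j → Lplus F Y (fromℕ n) j ≡ 0#
  Lplus-last {zero}  Y j = ≡.refl
  Lplus-last {suc n} Y j = Lplus-last (Y ∘ suc) j

  detC-Lplus : ∀ {n k} (Y : Mat F n k) → detC F (Lplus F Y) ≈ detC F Y
  detC-Lplus Y = trans (detC-zero-last-row (Lplus F Y) (reflexive ∘ Lplus-last Y))
                       (detC-cong {X = Lplus F Y ∘ inject₁} {Y} (λ r j → reflexive (Lplus-inject₁ Y r j)))

  -- The term of Σ_r ε r * detC (removeAt W r), expanded once more, that removes rows r and t of W.
  doubleMinorTerm : ∀ {m k} → Mat F (suc (suc m)) (suc k) → Fin (suc (suc m)) → Fin (suc (suc m)) → Carrier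
  doubleMinorTerm W r t with r ≟ t
  ... | yes _   = 0#
  ... | no r≢t = ε r * ((ε (punchOut r≢t) * W t zero) * detC F (minor (punchOut r≢t) (removeAt W r)))

  doubleMinorTerm-diag : ∀ {m k} (W : Mat F (suc (suc m)) (suc k)) r → doubleMinorTerm W r r ≈ 0#
  doubleMinorTerm-diag W r with r ≟ r
  ... | yes _   = refl
  ... | no r≢r = contradiction ≡.refl r≢r

  doubleMinorTerm-punchIn : ∀ {m k} (W : Mat F (suc (suc m)) (suc k)) r s →
    ε r * ((ε s * W (punchIn r s) zero) * detC F (minor s (removeAt W r))) ≈ doubleMinorTerm W r (punchIn r s)
  doubleMinorTerm-punchIn W r s with r ≟ punchIn r s
  ... | yes r≡r′ = contradiction (≡.sym r≡r′) (Finₚ.punchInᵢ≢i r s)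
  ... | no r≢r′  = reflexive (≡.cong (λ s′ → ε r * ((ε s′ * W (punchIn r s) zero) * detC F (minor s′ (removeAt W r))))
                                    (≡.sym (Finₚ.punchIn-injective r _ _ (Finₚ.punchIn-punchOut r≢r′))))

  doubleMinorTerm-swap : ∀ {m k} (W : Mat F (suc (suc m)) (suc k)) t u →
    doubleMinorTerm W (punchIn t u) t ≈ (- (ε t * W t zero)) * (ε u * detC F (removeAt (minor t W) u))
  doubleMinorTerm-swap {m} W t u with punchIn t u ≟ t
  ... | yes r≡t = contradiction r≡t (Finₚ.punchInᵢ≢i t u)
  ... | no r≢t  = begin
    ε r * ((ε (punchOut r≢t) * x) * detC F (minor (punchOut r≢t) (removeAt W r)))
      ≡⟨ ≡.cong (λ t′ → ε r * ((ε t′ * x) * detC F (minor t′ (removeAt W r)))) (punchOut-swapIndex t u r≢t) ⟩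
    ε r * ((ε t′ * x) * detC F (minor t′ (removeAt W r)))
      ≈⟨ *-congˡ (*-congˡ (detC-cong {X = minor t′ (removeAt W r)} {removeAt (minor t W) u}
           (λ v j → reflexive (≡.cong (λ i → W i (suc j)) (punchIn-punchIn-swapIndex t u v))))) ⟩
    ε r * ((ε t′ * x) * D)
      ≈⟨ trans (*-congˡ (*-assoc (ε t′) x D)) (sym (*-assoc (ε r) (ε t′) (x * D))) ⟩
    (ε r * ε t′) * (x * D)
      ≈⟨ *-congʳ (negOnePow-swapIndex t u) ⟩
    (- (ε t * ε u)) * (x * D)
      ≈⟨ -‿distribˡ-* (ε t * ε u) (x * D) ⟨
    - ((ε t * ε u) * (x * D))
      ≈⟨ -‿cong (interchange (ε t) (ε u) x D) ⟩
    - ((ε t * x) * (ε u * D))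
      ≈⟨ -‿distribˡ-* (ε t * x) (ε u * D) ⟩
    (- (ε t * x)) * (ε u * D)
      ∎
    where
    r : Fin (suc (suc m))
    r = punchIn t u
    t′ : Fin (suc m)
    t′ = swapIndex t u
    x D : Carrier
    x = W t zero
    D = detC F (removeAt (minor t W) u)

  -- The parity condition is what makes the base case Σ_r (-1)ʳ vanish.
  detC-alternating-minors : ∀ {m k} (W : Mat F (suc m) k) → (suc m ℕ.+ k) % 2 ≡ 0 →
                            sum (λ r → ε r * detC F (removeAt W r)) ≈ 0#
  detC-alternating-minors {m} {zero} W even = begin
    sum (λ r → ε r * detC F (removeAt W r)) ≈⟨ sum-cong-≋ (λ r → trans (*-congˡ (detC-no-columns (removeAt W r))) (*-identityʳ (ε r))) ⟩
    sum {suc m} ε                           ≈⟨ sum-negOnePow (suc m) (≡.trans (≡.cong (_% 2) (≡.sym (ℕₚ.+-identityʳ (suc m)))) even) ⟩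
    0#                                      ∎
  detC-alternating-minors {zero}  {suc k} W even = trans (+-identityʳ _) (zeroʳ _)
  detC-alternating-minors {suc m} {suc k} W even = begin
    sum (λ r → ε r * detC F (removeAt W r))
      ≈⟨ sum-cong-≋ (λ r → trans (*-congˡ (detC-expand (removeAt W r)))
                                 (*-distribˡ-sum (ε r) (λ s → (ε s * W (punchIn r s) zero) * detC F (minor s (removeAt W r))))) ⟩
    sum (λ r → sum (λ s → ε r * ((ε s * W (punchIn r s) zero) * detC F (minor s (removeAt W r)))))
      ≈⟨ sum-cong-≋ (λ r → sum-cong-≋ (doubleMinorTerm-punchIn W r)) ⟩
    sum (λ r → sum (λ s → doubleMinorTerm W r (punchIn r s)))
      ≈⟨ sum-offDiagonal (doubleMinorTerm W) (doubleMinorTerm-diag W) ⟩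
    sum (λ t → sum (λ u → doubleMinorTerm W (punchIn t u) t))
      ≈⟨ sum-cong-≋ (λ t → sum-cong-≋ (doubleMinorTerm-swap W t)) ⟩
    sum (λ t → sum (λ u → (- (ε t * W t zero)) * (ε u * detC F (removeAt (minor t W) u))))
      ≈⟨ sum-zero _ (λ t → trans (sym (*-distribˡ-sum (- (ε t * W t zero)) (λ u → ε u * detC F (removeAt (minor t W) u))))
                                 (trans (*-congˡ (detC-alternating-minors (minor t W) even′)) (zeroʳ _))) ⟩
    0#
      ∎
    where
    even′ : (suc m ℕ.+ k) % 2 ≡ 0
    even′ = ≡.trans (≡.cong (_% 2) (≡.sym (ℕₚ.+-suc m k))) even

  sum-init-alternating-minors : ∀ {n k} (X : Mat F (suc (suc n)) (suc k)) → (suc (suc n) ℕ.+ k) % 2 ≡ 0 →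
    sum (λ r → ε r * detC F (minor (inject₁ r) X)) ≈ - (ε (fromℕ (suc n)) * detC F (minor (fromℕ (suc n)) X))
  sum-init-alternating-minors {n} X even = inverseˡ-unique _ _ (begin
    sum (λ r → ε r * detC F (minor (inject₁ r) X)) + ε (fromℕ (suc n)) * detC F (minor (fromℕ (suc n)) X)
      ≈⟨ +-congʳ (sum-cong-≋ (λ r → *-congʳ {detC F (minor (inject₁ r) X)} (reflexive (≡.cong (negOnePow F) (≡.sym (Finₚ.toℕ-inject₁ r)))))) ⟩
    sum (λ r → ε (inject₁ r) * detC F (minor (inject₁ r) X)) + ε (fromℕ (suc n)) * detC F (minor (fromℕ (suc n)) X)
      ≈⟨ sum-init-last (λ i → ε i * detC F (minor i X)) ⟨
    sum (λ i → ε i * detC F (minor i X))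
      ≈⟨ detC-alternating-minors (λ i j → X i (suc j)) even ⟩
    0#
      ∎)

  minor-Lminus : ∀ {n k} (X : Mat F (suc (suc n)) (suc k)) r → _≈ᴹ_ F (minor r (Lminus F X)) (Lminus F (minor (inject₁ r) X))
  minor-Lminus X r s j =
    reflexive (≡.cong₂ (λ a b → X a (suc j) - X b (suc j)) (≡.sym (punchIn-inject₁ r s)) (≡.sym (punchIn-inject₁-last r)))

  detC-Lminus : ∀ {n k} (X : Mat F (suc n) k) → k ≤ n → (suc n ℕ.+ k) % 2 ≡ 1 → detC F (Lminus F X) ≈ detC F X
  detC-Lminus {k = zero}  X _ _ = trans (detC-no-columns (Lminus F X)) (sym (detC-no-columns X))
  detC-Lminus {suc n} {suc k} X (s≤s k≤n) odd = begin
    detC F (Lminus F X)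
      ≈⟨ detC-expand (Lminus F X) ⟩
    sum (λ r → (ε r * (X (inject₁ r) zero - xₗ)) * detC F (minor r (Lminus F X)))
      ≈⟨ sum-cong-≋ (λ r → trans (*-congˡ (minor≈ r)) (split r)) ⟩
    sum (λ r → (ε r * X (inject₁ r) zero) * M r + (- xₗ) * (ε r * M r))
      ≈⟨ ∑-distrib-+ (λ r → (ε r * X (inject₁ r) zero) * M r) (λ r → (- xₗ) * (ε r * M r)) ⟩
    sum (λ r → (ε r * X (inject₁ r) zero) * M r) + sum (λ r → (- xₗ) * (ε r * M r))
      ≈⟨ +-cong (sum-cong-≋ λ r → *-congʳ {M r} (*-congʳ {X (inject₁ r) zero} (reflexive (≡.cong (negOnePow F) (Finₚ.toℕ-inject₁ r)))))
                (*-distribˡ-sum (- xₗ) (λ r → ε r * M r)) ⟨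
    sum (λ r → cofactorTerm X (inject₁ r)) + (- xₗ) * sum (λ r → ε r * M r)
      ≈⟨ +-congˡ lastTerm ⟩
    sum (λ r → cofactorTerm X (inject₁ r)) + cofactorTerm X (fromℕ (suc n))
      ≈⟨ sum-init-last (cofactorTerm X) ⟨
    sum (cofactorTerm X)
      ≈⟨ detC-expand X ⟨
    detC F X
      ∎
    where
    odd′ : (suc n ℕ.+ k) % 2 ≡ 1
    odd′ = ≡.trans (≡.cong (_% 2) (≡.sym (ℕₚ.+-suc n k))) odd
    xₗ : Carrier
    xₗ = X (fromℕ (suc n)) zero
    M : Fin (suc n) → Carrier
    M r = detC F (minor (inject₁ r) X)
    minor≈ : ∀ r → detC F (minor r (Lminus F X)) ≈ M r
    minor≈ r = trans (detC-cong {X = minor r (Lminus F X)} {Lminus F (minor (inject₁ r) X)} (minor-Lminus X r))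
                     (detC-Lminus (minor (inject₁ r) X) k≤n odd′)
    split : ∀ r → (ε r * (X (inject₁ r) zero - xₗ)) * M r ≈ (ε r * X (inject₁ r) zero) * M r + (- xₗ) * (ε r * M r)
    split r = begin
      (ε r * (X (inject₁ r) zero - xₗ)) * M r                     ≈⟨ *-congʳ (distribˡ (ε r) _ _) ⟩
      (ε r * X (inject₁ r) zero + ε r * (- xₗ)) * M r             ≈⟨ distribʳ (M r) _ _ ⟩
      (ε r * X (inject₁ r) zero) * M r + (ε r * (- xₗ)) * M r     ≈⟨ +-congˡ (trans (*-congʳ (*-comm (ε r) (- xₗ))) (*-assoc (- xₗ) (ε r) (M r))) ⟩
      (ε r * X (inject₁ r) zero) * M r + (- xₗ) * (ε r * M r)     ∎
    lastTerm : (- xₗ) * sum (λ r → ε r * M r) ≈ cofactorTerm X (fromℕ (suc n))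
    lastTerm = begin
      (- xₗ) * sum (λ r → ε r * M r)                                      ≈⟨ *-congˡ (sum-init-alternating-minors X (even-pred (n ℕ.+ k) odd′)) ⟩
      (- xₗ) * (- (ε (fromℕ (suc n)) * detC F (minor (fromℕ (suc n)) X))) ≈⟨ -x*-y≈x*y xₗ _ ⟩
      xₗ * (ε (fromℕ (suc n)) * detC F (minor (fromℕ (suc n)) X))         ≈⟨ *-assoc xₗ _ _ ⟨
      (xₗ * ε (fromℕ (suc n))) * detC F (minor (fromℕ (suc n)) X)         ≈⟨ *-congʳ (*-comm xₗ _) ⟩
      cofactorTerm X (fromℕ (suc n))                                      ∎

open CullisDeterminant using (detC-Lplus; detC-Lminus)
open import Data.Nat using (_+_)

lemma4p9 : ∀ {c ℓ : Level} (F : Field c ℓ) (n k : ℕ) →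
    CardGreaterThan F k →
    1 ≤ k → k < suc n → (suc n + k) % 2 ≡ 1 →
    (S : Mat F n k → Mat F n k) → IsLinear F S →
    (∀ Y → Field._≈_ F (detC F (S Y)) (detC F Y)) →
    ∀ X → Field._≈_ F (detC F (Lplus F (S (Lminus F X)))) (detC F X)
lemma4p9 F n k _ _ (s≤s k≤n) n+k-odd S _ S-preserves-detC X = begin
  detC F (Lplus F (S (Lminus F X)))  ≈⟨ detC-Lplus F (S (Lminus F X)) ⟩
  detC F (S (Lminus F X))            ≈⟨ S-preserves-detC (Lminus F X) ⟩
  detC F (Lminus F X)                ≈⟨ detC-Lminus F X k≤n n+k-odd ⟩
  detC F X                           ∎
  where open import Relation.Binary.Reasoning.Setoid (Field.setoid F)
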